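{- Let $n\ge 1$, let $G$ be a directed multigraph on the vertex set $[n+1]=\{1,\dots,n+1\}$ all of whose edges are of the form $(i,j)$ with $i<j$ (directed $i\to j$), and fix ${\bf c}=(c_1,\dots,c_n)\in\mathbb{Z}^n_{>0}$. For $i\in[n]$ set $a_i := {\bf in}_G(i)+c_i$. Then $$K_G\Big(a_1,\dots,a_n,-\sum_{i=1}^n a_i\Big)=K_{G({\bf c})}\Big(0,{\bf in}_{G({\bf c})}(1),\dots,{\bf in}_{G({\bf c})}(n),-\sum_{i=1}^n{\bf in}_{G({\bf c})}(i)\Big),$$ i.e. the number of integer points of the flow polytope $\mathcal F_G(a_1,\dots,a_n,-\sum_i a_i)$ equals the number of integer points of $\mathcal F_{G({\bf c})}(0,{\bf in}_{G({\bf c})}(1),\dots,{\bf in}_{G({\bf c})}(n),-\sum_i{\bf in}_{G({\bf c})}(i))$.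
   Context: For a directed multigraph $H$ on a vertex set $\{v_0<v_1<\dots<v_k\}$ of integers with all edges directed from smaller to larger vertex, and a vector ${\bf b}$ indexed by the vertices, the flow polytope is $\mathcal F_H({\bf b})=\{f\in\mathbb{R}^{E(H)}_{\ge 0}: M_H f={\bf b}\}$, where $M_H$ is the incidence matrix whose column for the edge $(i,j)$ is $e_i-e_j$ (parallel edges give separate coordinates). The (generalized) Kostant partition function $K_H({\bf b})$ is the number of integer points of $\mathcal F_H({\bf b})$, i.e. the number of ways to write ${\bf b}$ as a nonnegative integer combination of the vectors $e_i-e_j$, one for each edge $(i,j)$ of $H$ counted with multiplicity. ${\bf in}_H(i):=\mathrm{indeg}_H(i)-1$. For ${\bf c}\in\mathbb{Z}^n_{>0}$, the graph $G({\bf c})$ is the multigraph on vertex set $[0,n+1]=\{0,1,\dots,n+1\}$ obtained from $G$ by adding a vertex $0$ and, for each $i\in[n]$, $c_i$ parallel copies of the edge $(0,i)$. Vectors for $G({\bf c})$ are indexed by vertices $0,1,\dots,n+1$ in this order. -}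

module Defs where

open import Data.Nat as ℕ using (ℕ; zero; suc)
open import Data.Integer as ℤ using (ℤ; +_; _-_; -_)
open import Data.Fin as Fin using (Fin; zero; suc; inject₁; toℕ)
open import Data.Fin.Properties using () renaming (_≟_ to _≟ᶠ_)
open import Data.List as List using (List; []; _∷_; length; _++_; replicate; concatMap)
open import Data.List.Relation.Unary.All using (All)
open import Data.Vec as Vec using (Vec; []; _∷_; tabulate; _∷ʳ_)
open import Data.Product using (Σ; _×_; _,_)
open import Data.Bool using (if_then_else_)
open import Relation.Nullary using (does)
open import Relation.Binary.PropositionalEquality using (_≡_)
open import Function.Bundles using (_↔_)

-- A directed multigraph on vertex set Fin V, given as a list of edges
-- (i , j) meaning i → j; repeated entries are parallel edges.
Edge : ℕ → Set
Edge V = Fin V × Fin V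

Multigraph : ℕ → Set
Multigraph V = List (Edge V)

Increasing : ∀ {V} → Multigraph V → Set
Increasing E = All (λ { (i , j) → toℕ i ℕ.< toℕ j }) E

[_≡?_]·_ : ∀ {V} → Fin V → Fin V → ℕ → ℤ
[ u ≡? v ]· x = if does (u ≟ᶠ v) then + x else + 0

netFlowAt : ∀ {V} (E : Multigraph V) → Vec ℕ (length E) → Fin V → ℤ
netFlowAt [] [] v = + 0
netFlowAt ((i , j) ∷ E) (x ∷ f) v =
  ([ i ≡? v ]· x) - ([ j ≡? v ]· x) ℤ.+ netFlowAt E f v

incidenceApply : ∀ {V} (E : Multigraph V) → Vec ℕ (length E) → Vec ℤ V
incidenceApply E f = tabulate (netFlowAt E f)

-- integer points of the flow polytope F_H(b): nonnegative integer flows f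
-- (one coordinate per edge, parallel edges separate) with M_H f = b
IntFlows : ∀ {V} → Multigraph V → Vec ℤ V → Set
IntFlows E b = Σ (Vec ℕ (length E)) (λ f → incidenceApply E f ≡ b)

HasCard : Set → ℕ → Set
HasCard A k = A ↔ Fin k

KostantIs : ∀ {V} → Multigraph V → Vec ℤ V → ℕ → Set
KostantIs E b k = HasCard (IntFlows E b) k

indeg : ∀ {V} → Multigraph V → Fin V → ℕ
indeg [] v = 0
indeg ((i , j) ∷ E) v = (if does (j ≟ᶠ v) then 1 else 0) ℕ.+ indeg E v

inH : ∀ {V} → Multigraph V → Fin V → ℤ
inH E v = + indeg E v - + 1

sumℤ : ∀ {m} → Vec ℤ m → ℤ
sumℤ [] = + 0
sumℤ (x ∷ xs) = x ℤ.+ sumℤ xs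

-- Conventions: G lives on Fin (suc n); index k stands for vertex k+1 of [n+1].
-- The vertex i ∈ [n] corresponds to inject₁ i for i : Fin n (value i-1).
-- G(c) lives on Fin (suc (suc n)); index k stands for vertex k of [0,n+1].

liftEdge : ∀ {V} → Edge V → Edge (suc V)
liftEdge (i , j) = (suc i , suc j)

-- G(c): shift G by one and add c_i parallel copies of (0, i), i ∈ [n]
extendGraph : ∀ {n} → Multigraph (suc n) → (Fin n → ℕ) → Multigraph (suc (suc n))
extendGraph {n} E c =
  List.map liftEdge E ++
  concatMap (λ i → replicate (c i) (zero , suc (inject₁ i))) (List.allFin n)

aVec : ∀ {n} → Multigraph (suc n) → (Fin n → ℕ) → Vec ℤ n
aVec E c = tabulate (λ i → inH E (inject₁ i) ℤ.+ + c i)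

netG : ∀ {n} → Multigraph (suc n) → (Fin n → ℕ) → Vec ℤ (suc n)
netG E c = aVec E c ∷ʳ (- sumℤ (aVec E c))

netGc : ∀ {n} → Multigraph (suc n) → (Fin n → ℕ) → Vec ℤ (suc (suc n))
netGc {n} E c = + 0 ∷ (ins ∷ʳ (- sumℤ ins))
  where
  ins : Vec ℤ n
  ins = tabulate (λ i → inH (extendGraph E c) (suc (inject₁ i)))

module Submission where

-- The edges of G(c) outside the shifted copy of G all leave the new vertex 0, so the
-- condition "net flow 0 at vertex 0" forces them to carry no flow: integer flows of G(c)
-- with net flow (0, b) are exactly the shifted integer flows of G with net flow b. Since
-- in_{G(c)}(i) = in_G(i) + c_i = a_i, the two net-flow vectors agree. It remains that the common count exists: for an increasing graph the
-- weight Σ_v v·b_v of the net flow b = M f equals -Σ_{(i,j)} (j - i) f_(i,j), so the total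
-- flow is at most |Σ_v v·b_v| and there are only finitely many integer flows.

open import Defs
open import Data.Nat using (ℕ; suc; _≤_; _<_)
open import Data.Fin using (Fin)
open import Data.Product using (Σ; _×_)

open import Algebra.Bundles using (CommutativeMonoid)
import Algebra.Properties.CommutativeMonoid.Sum as MonoidSum
open import Axiom.UniquenessOfIdentityProofs using (module Decidable⇒UIP)
open import Data.Bool using (true; false; if_then_else_)
open import Data.Fin as Fin using (zero; suc; toℕ; inject₁; punchIn)
import Data.Fin.Properties as FinP
open import Data.Integer using (ℤ; +_; -_; _+_; _-_; _*_; _⊖_; ∣_∣)
import Data.Integer.Properties as ℤP
open import Data.List as List using (List; []; _∷_; length; _++_; replicate; concat; concatMap)
import Data.List.Properties as ListP
open import Data.List.Relation.Unary.All using (All; []; _∷_)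
open import Data.List.Relation.Unary.All.Properties using (concat⁺; map⁺; tabulate⁺; replicate⁺)
import Data.Nat as ℕ
import Data.Nat.Properties as ℕP
open import Data.Product using (_,_; proj₁; proj₂; ∃; map₁; uncurry)
open import Data.Sum using (_⊎_; inj₁; inj₂)
open import Data.Sum.Function.Propositional using (_⊎-↔_)
open import Data.Vec as Vec using (Vec; []; _∷_; lookup; cast)
open import Data.Vec.Properties using (≡-dec; tabulate-cong; lookup∘tabulate; cast-sym)
open import Data.Vec.Functional using (Vector)
open import Function using (_∘_; id)
open import Function.Bundles using (_↔_; mk↔ₛ′)
open import Function.Definitions using (Injective)
open import Function.Properties.Inverse using (↔-trans; ↔-sym)
open import Relation.Nullary using (Dec; yes; no; does; Irrelevant)
open import Relation.Nullary.Decidable using (True-↔; dec-true; dec-false)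
open import Relation.Binary.PropositionalEquality
open import Algebra.Properties.CommutativeSemigroup ℤP.+-commutativeSemigroup using (xy∙z≈xz∙y)

Finite : Set → Set
Finite A = Σ ℕ (λ k → A ↔ Fin k)

↔-finite : {A B : Set} → A ↔ B → Finite B → Finite A
↔-finite A↔B (k , B↔k) = k , ↔-trans A↔B B↔k

Dec-finite : {P : Set} → Dec P → Irrelevant P → Finite P
Dec-finite p?@(yes _) irr = 1 , ↔-trans (↔-sym (True-↔ p? irr)) (↔-sym FinP.1↔⊤)
Dec-finite p?@(no _)  irr = 0 , ↔-trans (↔-sym (True-↔ p? irr)) (↔-sym FinP.0↔⊥)

Σ-Fin-finite : ∀ k (B : Fin k → Set) → (∀ i → Finite (B i)) → Finite (Σ (Fin k) B)
Σ-Fin-finite 0       B _   = 0 , mk↔ₛ′ (λ { (() , _) }) (λ ()) (λ ()) (λ { (() , _) })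
Σ-Fin-finite (suc k) B fin with fin zero | Σ-Fin-finite k (B ∘ suc) (fin ∘ suc)
... | a , B₀↔a | s , Bₛ↔s =
  a ℕ.+ s , ↔-trans peel (↔-trans (B₀↔a ⊎-↔ Bₛ↔s) (↔-sym FinP.+↔⊎))
  where
  peel : Σ (Fin (suc k)) B ↔ (B zero ⊎ Σ (Fin k) (B ∘ suc))
  peel = mk↔ₛ′ (λ { (zero , b) → inj₁ b ; (suc i , b) → inj₂ (i , b) })
               (λ { (inj₁ b) → zero , b ; (inj₂ (i , b)) → suc i , b })
               (λ { (inj₁ _) → refl ; (inj₂ _) → refl })
               (λ { (zero , _) → refl ; (suc _ , _) → refl })

Σ-Vec-finite : ∀ k m (Q : Vec (Fin k) m → Set) →
               (∀ v → Dec (Q v)) → (∀ v → Irrelevant (Q v)) → Finite (Σ (Vec (Fin k) m) Q)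
Σ-Vec-finite k 0 Q dec irr = ↔-finite nil (Dec-finite (dec []) (irr []))
  where
  nil : Σ (Vec (Fin k) 0) Q ↔ Q []
  nil = mk↔ₛ′ (λ { ([] , q) → q }) ([] ,_) (λ _ → refl) (λ { ([] , _) → refl })
Σ-Vec-finite k (suc m) Q dec irr =
  ↔-finite uncons (Σ-Fin-finite k _ λ x →
    Σ-Vec-finite k m (Q ∘ (x ∷_)) (dec ∘ (x ∷_)) (irr ∘ (x ∷_)))
  where
  uncons : Σ (Vec (Fin k) (suc m)) Q ↔ Σ (Fin k) (λ x → Σ (Vec (Fin k) m) (Q ∘ (x ∷_)))
  uncons = mk↔ₛ′ (λ { ((x ∷ v) , q) → x , v , q }) (λ { (x , v , q) → (x ∷ v) , q })
                 (λ _ → refl) (λ { ((_ ∷ _) , _) → refl })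

Σ-≡-irrelevant : {A : Set} {P : A → Set} → (∀ a → Irrelevant (P a)) →
                 ∀ {a a'} {p : P a} {p' : P a'} → a ≡ a' → (a , p) ≡ (a' , p')
Σ-≡-irrelevant irr {p = p} {p'} refl = cong (_ ,_) (irr _ p p')

toFinVec : ∀ {m} B (f : Vec ℕ m) → Vec.sum f ≤ B → Vec (Fin (suc B)) m
toFinVec B []      _ = []
toFinVec B (x ∷ f) p =
  Fin.fromℕ< (ℕ.s≤s (ℕP.m+n≤o⇒m≤o x p)) ∷ toFinVec B f (ℕP.m+n≤o⇒n≤o x p)

map-toℕ-toFinVec : ∀ {m} B (f : Vec ℕ m) p → Vec.map toℕ (toFinVec B f p) ≡ f
map-toℕ-toFinVec B []      _ = refl
map-toℕ-toFinVec B (x ∷ f) _ = cong₂ _∷_ (FinP.toℕ-fromℕ< _) (map-toℕ-toFinVec B f _)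

toFinVec-map-toℕ : ∀ {m} B (g : Vec (Fin (suc B)) m) p → toFinVec B (Vec.map toℕ g) p ≡ g
toFinVec-map-toℕ B []      _ = refl
toFinVec-map-toℕ B (x ∷ g) _ = cong₂ _∷_ (FinP.fromℕ<-toℕ x _) (toFinVec-map-toℕ B g _)

bounded-Σ-Vec-finite : ∀ {m} B (Q : Vec ℕ m → Set) →
                       (∀ f → Dec (Q f)) → (∀ f → Irrelevant (Q f)) → (∀ f → Q f → Vec.sum f ≤ B) →
                       Finite (Σ (Vec ℕ m) Q)
bounded-Σ-Vec-finite {m} B Q dec irr bound =
  ↔-finite bounded (Σ-Vec-finite (suc B) m (Q ∘ Vec.map toℕ) (dec ∘ Vec.map toℕ) (irr ∘ Vec.map toℕ))
  where
  bounded : Σ (Vec ℕ m) Q ↔ Σ (Vec (Fin (suc B)) m) (Q ∘ Vec.map toℕ)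
  bounded = mk↔ₛ′
    (λ (f , q) → toFinVec B f (bound f q) , subst Q (sym (map-toℕ-toFinVec B f _)) q)
    (λ (g , q) → Vec.map toℕ g , q)
    (λ (g , _) → Σ-≡-irrelevant (irr ∘ Vec.map toℕ) (toFinVec-map-toℕ B g _))
    (λ (f , _) → Σ-≡-irrelevant irr (map-toℕ-toFinVec B f _))

module _ {c ℓ} (M : CommutativeMonoid c ℓ) where
  open CommutativeMonoid M using (Carrier; _≈_; _∙_; ε; ∙-congˡ; identityʳ)
  open MonoidSum M using (sum; sum-remove; sum-cong-≋; sum-replicate-zero)
  open import Relation.Binary.Reasoning.Setoid (CommutativeMonoid.setoid M)

  sum-concentrated : ∀ {n} (t : Vector Carrier (suc n)) i → (∀ j → j ≢ i → t j ≈ ε) → sum t ≈ t i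
  sum-concentrated {n} t i vanish = begin
    sum t                          ≈⟨ sum-remove {i = i} t ⟩
    t i ∙ sum (t ∘ punchIn i)      ≈⟨ ∙-congˡ (sum-cong-≋ λ j → vanish _ (FinP.punchInᵢ≢i i j)) ⟩
    t i ∙ sum {n} (λ _ → ε)        ≈⟨ ∙-congˡ (sum-replicate-zero n) ⟩
    t i ∙ ε                        ≈⟨ identityʳ (t i) ⟩
    t i                            ∎

open ≡-Reasoning

module ℕΣ = MonoidSum ℕP.+-0-commutativeMonoid
module ℤΣ = MonoidSum ℤP.+-0-commutativeMonoid

sum-neg : ∀ {V} (t : Vector ℤ V) → ℤΣ.sum (λ v → - t v) ≡ - ℤΣ.sum t
sum-neg {0}     t = refl
sum-neg {suc V} t = trans (cong (_+_ (- t zero)) (sum-neg (t ∘ suc))) (sym (ℤP.neg-distrib-+ (t zero) _))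

[≡?]·-refl : ∀ {V} (v : Fin V) x → [ v ≡? v ]· x ≡ + x
[≡?]·-refl v x rewrite dec-true (v FinP.≟ v) refl = refl

[≡?]·-≢ : ∀ {V} {u v : Fin V} x → u ≢ v → [ u ≡? v ]· x ≡ + 0
[≡?]·-≢ {u = u} {v} x u≢v rewrite dec-false (u FinP.≟ v) u≢v = refl

[≡?]·-zero : ∀ {V} (u v : Fin V) → [ u ≡? v ]· 0 ≡ + 0
[≡?]·-zero u v with does (u FinP.≟ v)
... | true  = refl
... | false = refl

weight : ∀ {V} → Vector ℤ V → ℤ
weight g = ℤΣ.sum (λ v → + toℕ v * g v)

weight-+ : ∀ {V} (g h : Vector ℤ V) → weight (λ v → g v + h v) ≡ weight g + weight h
weight-+ {V} g h =
  trans (ℤΣ.sum-cong-≗ {V} λ v → ℤP.*-distribˡ-+ (+ toℕ v) (g v) (h v)) (ℤΣ.∑-distrib-+ {V} _ _)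

weight-neg : ∀ {V} (g : Vector ℤ V) → weight (λ v → - g v) ≡ - weight g
weight-neg {V} g =
  trans (ℤΣ.sum-cong-≗ {V} λ v → sym (ℤP.neg-distribʳ-* (+ toℕ v) (g v))) (sum-neg {V} _)

weight-indicator : ∀ {V} (i : Fin V) x → weight (λ v → [ i ≡? v ]· x) ≡ + toℕ i * + x
weight-indicator {suc V} i x =
  trans (sum-concentrated ℤP.+-0-commutativeMonoid _ i vanish) (cong (_*_ (+ toℕ i)) ([≡?]·-refl i x))
  where
  vanish : ∀ v → v ≢ i → + toℕ v * [ i ≡? v ]· x ≡ + 0
  vanish v v≢i = trans (cong (_*_ (+ toℕ v)) ([≡?]·-≢ x (v≢i ∘ sym))) (ℤP.*-zeroʳ (+ toℕ v))

weight-edge : ∀ {V} {i j : Fin V} x → toℕ i ≤ toℕ j →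
              weight (λ v → [ i ≡? v ]· x - [ j ≡? v ]· x) ≡ - + ((toℕ j ℕ.∸ toℕ i) ℕ.* x)
weight-edge {V} {i} {j} x i≤j = begin
  weight (λ v → [ i ≡? v ]· x - [ j ≡? v ]· x)
    ≡⟨ weight-+ {V} _ _ ⟩
  weight (λ v → [ i ≡? v ]· x) + weight (λ v → - ([ j ≡? v ]· x))
    ≡⟨ cong₂ _+_ (weight-indicator i x) (trans (weight-neg {V} _) (cong -_ (weight-indicator j x))) ⟩
  + toℕ i * + x - + toℕ j * + x
    ≡⟨ cong₂ _-_ (sym (ℤP.pos-* (toℕ i) x)) (sym (ℤP.pos-* (toℕ j) x)) ⟩
  + (toℕ i ℕ.* x) - + (toℕ j ℕ.* x)
    ≡⟨ ℤP.[+m]-[+n]≡m⊖n (toℕ i ℕ.* x) (toℕ j ℕ.* x) ⟩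
  toℕ i ℕ.* x ⊖ toℕ j ℕ.* x
    ≡⟨ ℤP.⊖-≤ (ℕP.*-monoˡ-≤ x i≤j) ⟩
  - + (toℕ j ℕ.* x ℕ.∸ toℕ i ℕ.* x)
    ≡⟨ cong (-_ ∘ +_) (sym (ℕP.*-distribʳ-∸ x (toℕ j) (toℕ i))) ⟩
  - + ((toℕ j ℕ.∸ toℕ i) ℕ.* x) ∎

cost : ∀ {V} (E : Multigraph V) → Vec ℕ (length E) → ℕ
cost []            []      = 0
cost ((i , j) ∷ E) (x ∷ f) = (toℕ j ℕ.∸ toℕ i) ℕ.* x ℕ.+ cost E f

weight-netFlowAt : ∀ {V} (E : Multigraph V) → Increasing E → (f : Vec ℕ (length E)) →
                   weight (netFlowAt E f) ≡ - + cost E f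
weight-netFlowAt {V} []            []          [] =
  trans (ℤΣ.sum-cong-≗ {V} λ v → ℤP.*-zeroʳ (+ toℕ v)) (ℤΣ.sum-replicate-zero V)
weight-netFlowAt {V} ((i , j) ∷ E) (i<j ∷ inc) (x ∷ f) = begin
  weight (netFlowAt ((i , j) ∷ E) (x ∷ f))
    ≡⟨ weight-+ {V} _ _ ⟩
  weight (λ v → [ i ≡? v ]· x - [ j ≡? v ]· x) + weight (netFlowAt E f)
    ≡⟨ cong₂ _+_ (weight-edge x (ℕP.<⇒≤ i<j)) (weight-netFlowAt E inc f) ⟩
  - + d + - + cost E f
    ≡⟨ sym (ℤP.neg-distrib-+ (+ d) (+ cost E f)) ⟩
  - (+ d + + cost E f)
    ≡⟨ cong -_ (sym (ℤP.pos-+ d (cost E f))) ⟩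
  - + (d ℕ.+ cost E f) ∎
  where d = (toℕ j ℕ.∸ toℕ i) ℕ.* x

sum≤cost : ∀ {V} (E : Multigraph V) → Increasing E → (f : Vec ℕ (length E)) → Vec.sum f ≤ cost E f
sum≤cost []            []          []      = ℕ.z≤n
sum≤cost ((i , j) ∷ E) (i<j ∷ inc) (x ∷ f) =
  ℕP.+-mono-≤ (ℕP.m≤n*m x (toℕ j ℕ.∸ toℕ i) {{ℕ.>-nonZero (ℕP.m<n⇒0<n∸m i<j)}})
              (sum≤cost E inc f)

sum≤∣weight∣ : ∀ {V} (E : Multigraph V) → Increasing E → (f : Vec ℕ (length E)) {b : Vec ℤ V} →
               incidenceApply E f ≡ b → Vec.sum f ≤ ∣ weight (lookup b) ∣
sum≤∣weight∣ {V} E inc f refl = subst (Vec.sum f ≤_) cost≡∣weight∣ (sum≤cost E inc f)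
  where
  cost≡∣weight∣ : cost E f ≡ ∣ weight (lookup (incidenceApply E f)) ∣
  cost≡∣weight∣ = begin
    cost E f                                    ≡⟨ sym (ℤP.∣-i∣≡∣i∣ (+ cost E f)) ⟩
    ∣ - + cost E f ∣                            ≡⟨ cong ∣_∣ (sym (weight-netFlowAt E inc f)) ⟩
    ∣ weight (netFlowAt E f) ∣                  ≡⟨ cong ∣_∣ (ℤΣ.sum-cong-≗ {V} λ v →
                                                     cong (_*_ (+ toℕ v)) (sym (lookup∘tabulate _ v))) ⟩
    ∣ weight (lookup (incidenceApply E f)) ∣    ∎

Vecℤ-≡-irrelevant : ∀ {V} {u w : Vec ℤ V} → Irrelevant (u ≡ w)
Vecℤ-≡-irrelevant = Decidable⇒UIP.≡-irrelevant (≡-dec ℤP._≟_)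

IntFlows-finite : ∀ {V} (E : Multigraph V) → Increasing E → (b : Vec ℤ V) → Finite (IntFlows E b)
IntFlows-finite E inc b =
  bounded-Σ-Vec-finite ∣ weight (lookup b) ∣ _ (λ f → ≡-dec ℤP._≟_ _ b) (λ _ → Vecℤ-≡-irrelevant)
                       (λ f → sum≤∣weight∣ E inc f)

++-split : ∀ {X C : Set} (A B : List X) → Vec C (length (A ++ B)) → Vec C (length A) × Vec C (length B)
++-split []      B h       = [] , h
++-split (_ ∷ A) B (x ∷ h) = map₁ (x ∷_) (++-split A B h)

++-join : ∀ {X C : Set} (A B : List X) → Vec C (length A) → Vec C (length B) → Vec C (length (A ++ B))
++-join []      B []      g = g
++-join (_ ∷ A) B (x ∷ f) g = x ∷ ++-join A B f g

++-split-join : ∀ {X C : Set} (A B : List X) (f : Vec C (length A)) g →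
                ++-split A B (++-join A B f g) ≡ (f , g)
++-split-join []      B []      g = refl
++-split-join (_ ∷ A) B (x ∷ f) g = cong (map₁ (x ∷_)) (++-split-join A B f g)

++-join-split : ∀ {X C : Set} (A B : List X) (h : Vec C (length (A ++ B))) →
                uncurry (++-join A B) (++-split A B h) ≡ h
++-join-split []      B h       = refl
++-join-split (_ ∷ A) B (x ∷ h) = cong (x ∷_) (++-join-split A B h)

netFlowAt-++ : ∀ {V} (A B : Multigraph V) f g v →
               netFlowAt (A ++ B) (++-join A B f g) v ≡ netFlowAt A f v + netFlowAt B g v
netFlowAt-++ []            B []      g v = sym (ℤP.+-identityˡ _)
netFlowAt-++ ((i , j) ∷ A) B (x ∷ f) g v =
  trans (cong (_+_ e) (netFlowAt-++ A B f g v)) (sym (ℤP.+-assoc e _ _))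
  where e = [ i ≡? v ]· x - [ j ≡? v ]· x

netFlowAt-zeros : ∀ {V} (E : Multigraph V) v → netFlowAt E (Vec.replicate _ 0) v ≡ + 0
netFlowAt-zeros []            v = refl
netFlowAt-zeros ((i , j) ∷ E) v
  rewrite [≡?]·-zero i v | [≡?]·-zero j v = trans (ℤP.+-identityˡ _) (netFlowAt-zeros E v)

netFlowAt-liftEdge-zero : ∀ {V} (G : Multigraph V) h → netFlowAt (List.map liftEdge G) h zero ≡ + 0
netFlowAt-liftEdge-zero []      []      = refl
netFlowAt-liftEdge-zero (_ ∷ G) (_ ∷ h) = trans (ℤP.+-identityˡ _) (netFlowAt-liftEdge-zero G h)

netFlowAt-liftEdge-suc : ∀ {V} (G : Multigraph V) f v →
  netFlowAt (List.map liftEdge G) (cast (sym (ListP.length-map liftEdge G)) f) (suc v) ≡ netFlowAt G f v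
netFlowAt-liftEdge-suc []            []      v = refl
netFlowAt-liftEdge-suc ((i , j) ∷ G) (x ∷ f) v =
  cong (_+_ ([ i ≡? v ]· x - [ j ≡? v ]· x)) (netFlowAt-liftEdge-suc G f v)

FromZero : ∀ {V} → Edge (suc V) → Set
FromZero {V} e = ∃ λ (k : Fin V) → e ≡ (zero , suc k)

netFlowAt-FromZero : ∀ {V} (R : Multigraph (suc V)) → All FromZero R →
                     ∀ g → netFlowAt R g zero ≡ + Vec.sum g
netFlowAt-FromZero []      []               []      = refl
netFlowAt-FromZero (_ ∷ R) ((_ , refl) ∷ rs) (x ∷ g) =
  trans (cong₂ _+_ (ℤP.+-identityʳ (+ x)) (netFlowAt-FromZero R rs g)) (sym (ℤP.pos-+ x (Vec.sum g)))

fan-FromZero : ∀ {n V} (c : Fin n → ℕ) (τ : Fin n → Fin V) →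
               All FromZero (concatMap (λ k → replicate (c k) (zero , suc (τ k))) (List.allFin n))
fan-FromZero c τ = concat⁺ (map⁺ (tabulate⁺ λ k → replicate⁺ (c k) (τ k , refl)))

sum≡0⇒≡zeros : ∀ {m} (g : Vec ℕ m) → Vec.sum g ≡ 0 → g ≡ Vec.replicate m 0
sum≡0⇒≡zeros []      _ = refl
sum≡0⇒≡zeros (x ∷ g) p =
  cong₂ _∷_ (ℕP.m+n≡0⇒m≡0 x p) (sum≡0⇒≡zeros g (ℕP.m+n≡0⇒n≡0 x p))

module _ {V} (G : Multigraph V) (R : Multigraph (suc V)) (fromZero : All FromZero R) where
  private
    L : Multigraph (suc V)
    L = List.map liftEdge G

    ℓ : length L ≡ length G
    ℓ = ListP.length-map liftEdge G

  netFlowAt-++-zero : ∀ f g → netFlowAt (L ++ R) (++-join L R f g) zero ≡ + Vec.sum g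
  netFlowAt-++-zero f g =
    trans (netFlowAt-++ L R f g zero)
          (cong₂ _+_ (netFlowAt-liftEdge-zero G f) (netFlowAt-FromZero R fromZero g))

  liftFlow : Vec ℕ (length G) → Vec ℕ (length (L ++ R))
  liftFlow f = ++-join L R (cast (sym ℓ) f) (Vec.replicate _ 0)

  unliftFlow : Vec ℕ (length (L ++ R)) → Vec ℕ (length G)
  unliftFlow h = cast ℓ (proj₁ (++-split L R h))

  incidenceApply-liftFlow : ∀ f → incidenceApply (L ++ R) (liftFlow f) ≡ + 0 ∷ incidenceApply G f
  incidenceApply-liftFlow f = cong₂ _∷_ at-zero (tabulate-cong at-suc)
    where
    at-zero : netFlowAt (L ++ R) (liftFlow f) zero ≡ + 0
    at-zero = trans (netFlowAt-++ L R _ _ zero)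
                    (cong₂ _+_ (netFlowAt-liftEdge-zero G _) (netFlowAt-zeros R zero))
    at-suc : ∀ v → netFlowAt (L ++ R) (liftFlow f) (suc v) ≡ netFlowAt G f v
    at-suc v = trans (netFlowAt-++ L R _ _ (suc v))
                     (trans (cong₂ _+_ (netFlowAt-liftEdge-suc G f v) (netFlowAt-zeros R (suc v)))
                            (ℤP.+-identityʳ _))

  unliftFlow-liftFlow : ∀ f → unliftFlow (liftFlow f) ≡ f
  unliftFlow-liftFlow f = begin
    cast ℓ (proj₁ (++-split L R (liftFlow f))) ≡⟨ cong (cast ℓ ∘ proj₁) (++-split-join L R _ _) ⟩
    cast ℓ (cast (sym ℓ) f)                     ≡⟨ cast-sym (sym ℓ) refl ⟩
    f                                           ∎

  liftFlow-unliftFlow : ∀ h → netFlowAt (L ++ R) h zero ≡ + 0 → liftFlow (unliftFlow h) ≡ h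
  liftFlow-unliftFlow h h₀≡0 = begin
    ++-join L R (cast (sym ℓ) (cast ℓ f)) (Vec.replicate _ 0)
      ≡⟨ cong₂ (++-join L R) (cast-sym ℓ refl) (sym g≡0) ⟩
    ++-join L R f g
      ≡⟨ ++-join-split L R h ⟩
    h ∎
    where
    f = proj₁ (++-split L R h)
    g = proj₂ (++-split L R h)
    g≡0 : g ≡ Vec.replicate _ 0
    g≡0 = sum≡0⇒≡zeros g (ℤP.+-injective (begin
      + Vec.sum g
        ≡⟨ sym (netFlowAt-++-zero f g) ⟩
      netFlowAt (L ++ R) (++-join L R f g) zero
        ≡⟨ cong (λ h → netFlowAt (L ++ R) h zero) (++-join-split L R h) ⟩
      netFlowAt (L ++ R) h zero
        ≡⟨ h₀≡0 ⟩
      + 0 ∎))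

  IntFlows-liftEdge-↔ : ∀ b → IntFlows G b ↔ IntFlows (L ++ R) (+ 0 ∷ b)
  IntFlows-liftEdge-↔ b = mk↔ₛ′
    (λ (f , Mf≡b) → liftFlow f , trans (incidenceApply-liftFlow f) (cong (+ 0 ∷_) Mf≡b))
    (λ (h , Mh≡0b) → unliftFlow h , cong Vec.tail (begin
      + 0 ∷ incidenceApply G (unliftFlow h)
        ≡⟨ sym (incidenceApply-liftFlow (unliftFlow h)) ⟩
      incidenceApply (L ++ R) (liftFlow (unliftFlow h))
        ≡⟨ cong (incidenceApply (L ++ R)) (liftFlow-unliftFlow h (cong Vec.head Mh≡0b)) ⟩
      incidenceApply (L ++ R) h
        ≡⟨ Mh≡0b ⟩
      + 0 ∷ b ∎))
    (λ (h , Mh≡0b) → Σ-≡-irrelevant (λ _ → Vecℤ-≡-irrelevant)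
                                    (liftFlow-unliftFlow h (cong Vec.head Mh≡0b)))
    (λ (f , _) → Σ-≡-irrelevant (λ _ → Vecℤ-≡-irrelevant) (unliftFlow-liftFlow f))

indeg-++ : ∀ {V} (A B : Multigraph V) v → indeg (A ++ B) v ≡ indeg A v ℕ.+ indeg B v
indeg-++ []            B v = refl
indeg-++ ((_ , j) ∷ A) B v =
  trans (cong (ℕ._+_ (if does (j FinP.≟ v) then 1 else 0)) (indeg-++ A B v))
        (sym (ℕP.+-assoc (if does (j FinP.≟ v) then 1 else 0) _ _))

indeg-liftEdge : ∀ {V} (G : Multigraph V) v → indeg (List.map liftEdge G) (suc v) ≡ indeg G v
indeg-liftEdge []            v = refl
indeg-liftEdge ((_ , j) ∷ G) v = cong (ℕ._+_ (if does (j FinP.≟ v) then 1 else 0)) (indeg-liftEdge G v)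

indeg-replicate-self : ∀ {V} m (u t : Fin V) → indeg (replicate m (u , t)) t ≡ m
indeg-replicate-self 0       u t = refl
indeg-replicate-self (suc m) u t rewrite dec-true (t FinP.≟ t) refl = cong suc (indeg-replicate-self m u t)

indeg-replicate-≢ : ∀ {V} m (u : Fin V) {t w} → t ≢ w → indeg (replicate m (u , t)) w ≡ 0
indeg-replicate-≢ 0       u     t≢w = refl
indeg-replicate-≢ (suc m) u {t} {w} t≢w rewrite dec-false (t FinP.≟ w) t≢w = indeg-replicate-≢ m u t≢w

indeg-concat-tabulate : ∀ {n V} (h : Fin n → Multigraph V) w →
                        indeg (concat (List.tabulate h)) w ≡ ℕΣ.sum (λ k → indeg (h k) w)
indeg-concat-tabulate {0}     h w = refl
indeg-concat-tabulate {suc n} h w =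
  trans (indeg-++ (h zero) _ w) (cong (ℕ._+_ (indeg (h zero) w)) (indeg-concat-tabulate (h ∘ suc) w))

indeg-fan : ∀ {n V} (c : Fin n → ℕ) (u : Fin V) (τ : Fin n → Fin V) → Injective _≡_ _≡_ τ →
            ∀ i → indeg (concatMap (λ k → replicate (c k) (u , τ k)) (List.allFin n)) (τ i) ≡ c i
indeg-fan {suc n} c u τ τ-injective i = begin
  indeg (concatMap fan (List.allFin (suc n))) (τ i)
    ≡⟨ cong (λ es → indeg (concat es) (τ i)) (ListP.map-tabulate id fan) ⟩
  indeg (concat (List.tabulate fan)) (τ i)
    ≡⟨ indeg-concat-tabulate fan (τ i) ⟩
  ℕΣ.sum (λ k → indeg (fan k) (τ i))
    ≡⟨ sum-concentrated ℕP.+-0-commutativeMonoid _ i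
         (λ k k≢i → indeg-replicate-≢ (c k) u (k≢i ∘ τ-injective)) ⟩
  indeg (fan i) (τ i)
    ≡⟨ indeg-replicate-self (c i) u (τ i) ⟩
  c i ∎
  where
  fan : Fin (suc n) → Multigraph _
  fan k = replicate (c k) (u , τ k)

indeg-extendGraph : ∀ {n} (G : Multigraph (suc n)) (c : Fin n → ℕ) i →
                    indeg (extendGraph G c) (suc (inject₁ i)) ≡ indeg G (inject₁ i) ℕ.+ c i
indeg-extendGraph G c i =
  trans (indeg-++ (List.map liftEdge G) _ (suc (inject₁ i)))
        (cong₂ ℕ._+_ (indeg-liftEdge G (inject₁ i))
                     (indeg-fan c zero (suc ∘ inject₁) (FinP.inject₁-injective ∘ FinP.suc-injective) i))

netGc≡0∷netG : ∀ {n} (G : Multigraph (suc n)) (c : Fin n → ℕ) → netGc G c ≡ + 0 ∷ netG G c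
netGc≡0∷netG G c = cong (λ a → + 0 ∷ (a Vec.∷ʳ - sumℤ a)) (tabulate-cong inH-extendGraph)
  where
  inH-extendGraph : ∀ i → inH (extendGraph G c) (suc (inject₁ i)) ≡ inH G (inject₁ i) + + c i
  inH-extendGraph i = begin
    + indeg (extendGraph G c) (suc (inject₁ i)) - + 1 ≡⟨ cong (λ d → + d - + 1) (indeg-extendGraph G c i) ⟩
    + (d ℕ.+ c i) - + 1                               ≡⟨ cong (_- + 1) (ℤP.pos-+ d (c i)) ⟩
    + d + + c i - + 1                                 ≡⟨ xy∙z≈xz∙y (+ d) (+ c i) (- + 1) ⟩
    + d - + 1 + + c i                                 ∎
    where d = indeg G (inject₁ i)

lemma3p2 : (n : ℕ) → 1 ≤ n →
    (G : Multigraph (suc n)) → Increasing G →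
    (c : Fin n → ℕ) → (∀ i → 0 < c i) →
    Σ ℕ (λ k → KostantIs G (netG G c) k
             × KostantIs (extendGraph G c) (netGc G c) k)
lemma3p2 n _ G increasing c _ with IntFlows-finite G increasing (netG G c)
... | k , count =
  k , count , subst (λ b → KostantIs (extendGraph G c) b k) (sym (netGc≡0∷netG G c))
                    (↔-trans (↔-sym (IntFlows-liftEdge-↔ G _ (fan-FromZero c inject₁) (netG G c))) count)
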